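{- Let $k\ge 4$ be an integer, let $G'$ be an acyclic oriented graph containing no directed path with $k$ arcs, and let $W$ be an oriented path in $G'$. Then: (1) if $|A(W)|=kn$ for some positive integer $n$, then $|W^+|\le (k-1)n$ and $|W^-|\ge n$; (2) if the final arc of $W$ is a backward arc, then there is a positive integer $n$ such that $|W^+|\le (k-1)n$ and $|W^-|\ge n$.
   Context: An oriented path $W=w_1w_2\cdots w_r$ in an oriented graph $G'$ is a path in the underlying graph, traversed from $w_1$ to $w_r$; $A(W)$ is its set of arcs. An arc $(w_i,w_{i+1})$ of $W$ is a forward arc and an arc $(w_{i+1},w_i)$ is a backward arc; $W^+$ and $W^-$ denote the sets of forward and backward arcs of $W$. The final arc of $W$ is the arc between $w_{r-1}$ and $w_r$. -}

module Defs where

open import Data.Nat using (ℕ; zero; suc; _+_; _≤_)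
open import Data.Fin using (Fin; zero; suc; inject₁; fromℕ)
open import Data.Bool using (Bool; true; false; _∨_)
open import Data.Empty using (⊥)
open import Relation.Binary.PropositionalEquality using (_≡_)

record OrientedGraph : Set where
  field
    size     : ℕ
    arc      : Fin size → Fin size → Bool
    loopless : ∀ v → arc v v ≡ false
    oriented : ∀ u v → arc u v ≡ true → arc v u ≡ false

open OrientedGraph public

Vertex : OrientedGraph → Set
Vertex G = Fin (size G)

count : (m : ℕ) → (Fin m → Bool) → ℕ
count zero    p = 0
count (suc m) p = (if p zero then 1 else 0) + count m (λ i → p (suc i))
  where
  if_then_else_ : Bool → ℕ → ℕ → ℕ
  if true  then a else b = a
  if false then a else b = b

record DirectedPath (G : OrientedGraph) (ℓ : ℕ) : Set where
  field
    vtx      : Fin (suc ℓ) → Vertex G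
    distinct : ∀ i j → vtx i ≡ vtx j → i ≡ j
    forward  : ∀ (i : Fin ℓ) → arc G (vtx (inject₁ i)) (vtx (suc i)) ≡ true

record DirectedCycle (G : OrientedGraph) (ℓ : ℕ) : Set where
  field
    nonempty : 1 ≤ ℓ
    vtx      : Fin (suc ℓ) → Vertex G
    closed   : vtx zero ≡ vtx (fromℕ ℓ)
    distinct : ∀ (i j : Fin ℓ) → vtx (inject₁ i) ≡ vtx (inject₁ j) → i ≡ j
    forward  : ∀ (i : Fin ℓ) → arc G (vtx (inject₁ i)) (vtx (suc i)) ≡ true

Acyclic : OrientedGraph → Set
Acyclic G = ∀ ℓ → DirectedCycle G ℓ → ⊥

-- An oriented path W = w_1 … w_r with m = r - 1 arcs: distinct vertices, each
-- consecutive pair joined by an arc in some direction.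
record OrientedPath (G : OrientedGraph) (m : ℕ) : Set where
  field
    vtx      : Fin (suc m) → Vertex G
    distinct : ∀ i j → vtx i ≡ vtx j → i ≡ j
    adjacent : ∀ (i : Fin m) →
               (arc G (vtx (inject₁ i)) (vtx (suc i)) ∨ arc G (vtx (suc i)) (vtx (inject₁ i))) ≡ true

open OrientedPath public

numArcs : {G : OrientedGraph} {m : ℕ} → OrientedPath G m → ℕ
numArcs {m = m} W = m

numForward : {G : OrientedGraph} {m : ℕ} → OrientedPath G m → ℕ
numForward {G} {m} W = count m (λ i → arc G (vtx W (inject₁ i)) (vtx W (suc i)))

numBackward : {G : OrientedGraph} {m : ℕ} → OrientedPath G m → ℕ
numBackward {G} {m} W = count m (λ i → arc G (vtx W (suc i)) (vtx W (inject₁ i)))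

FinalArcBackward : {G : OrientedGraph} {m : ℕ} → OrientedPath G m → Set
FinalArcBackward {G} {zero}  W = ⊥
FinalArcBackward {G} {suc m} W =
  arc G (vtx W (suc (fromℕ m))) (vtx W (inject₁ (fromℕ m))) ≡ true

-- The vertices of W are distinct, so k consecutive forward arcs of W would form
-- a directed path with k arcs. Hence the forward arcs of W come in blocks of at
-- most k − 1, separated by backward arcs: |W⁺| ≤ (k − 1)(|W⁻| + 1), and even
-- |W⁺| ≤ (k − 1)|W⁻| when the last arc is backward. With |W⁺| + |W⁻| = kn the
-- first bound forces |W⁻| ≥ n and then |W⁺| ≤ (k − 1)n; for (2) take n = |W⁻|.
module Submission where

open import Defs
open import Data.Nat using (ℕ; _*_; _∸_; _≤_; _≥_)
open import Data.Product using (_×_; Σ)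
open import Relation.Binary.PropositionalEquality using (_≡_)
open import Relation.Nullary using (¬_)

open import Data.Bool using (Bool; true; false; not; _∨_; if_then_else_)
open import Data.Fin using (Fin; zero; suc; toℕ; inject₁; inject≤; fromℕ)
open import Data.Fin.Properties
  using (suc-injective; inject₁-injective; inject≤-injective; toℕ-injective; toℕ-inject₁; toℕ-inject≤; toℕ<n)
open import Data.Nat using (zero; suc; _+_; _<_; z≤n; s≤s; s≤s⁻¹)
open import Data.Nat.Properties
  using (≤-refl; ≤-reflexive; ≤-trans; <-≤-trans; ≮⇒≥; +-comm; +-suc; +-identityʳ; *-suc;
         +-monoˡ-≤; +-monoʳ-≤; +-cancelʳ-≤; *-cancelˡ-<; module ≤-Reasoning)
open import Data.Product using (_,_)
open import Data.Unit using (⊤; tt)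
open import Function using (_∘_)
open import Relation.Binary.PropositionalEquality using (refl; sym; trans; cong; subst; module ≡-Reasoning)

count-cong : ∀ m {p q : Fin m → Bool} → (∀ i → p i ≡ q i) → count m p ≡ count m q
count-cong zero    p≗q = refl
count-cong (suc m) {p} {q} p≗q with p zero | q zero | p≗q zero
... | true  | .true  | refl = cong suc (count-cong m (p≗q ∘ suc))
... | false | .false | refl = count-cong m (p≗q ∘ suc)

count-complement : ∀ m (p : Fin m → Bool) → count m p + count m (not ∘ p) ≡ m
count-complement zero    p = refl
count-complement (suc m) p with p zero
... | true  = cong suc (count-complement m (p ∘ suc))
... | false = trans (+-suc _ _) (cong suc (count-complement m (p ∘ suc)))

count-init : ∀ m (p : Fin (suc m) → Bool) →
             count (suc m) p ≡ count m (p ∘ inject₁) + count 1 (λ _ → p (fromℕ m))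
count-init zero    p = refl
count-init (suc m) p with p zero
... | true  = cong suc (count-init m (p ∘ suc))
... | false = count-init m (p ∘ suc)

count-init-false : ∀ m (p : Fin (suc m) → Bool) → p (fromℕ m) ≡ false →
                   count (suc m) p ≡ count m (p ∘ inject₁)
count-init-false m p last rewrite count-init m p | last = +-identityʳ _

count-init-true : ∀ m (p : Fin (suc m) → Bool) → p (fromℕ m) ≡ true →
                  count (suc m) p ≡ suc (count m (p ∘ inject₁))
count-init-true m p last rewrite count-init m p | last = +-comm _ 1

leadingTrues : ∀ m → (Fin m → Bool) → ℕ
leadingTrues zero    p = 0
leadingTrues (suc m) p = if p zero then suc (leadingTrues m (p ∘ suc)) else 0

leadingTrues≤length : ∀ m (p : Fin m → Bool) → leadingTrues m p ≤ m
leadingTrues≤length zero    p = z≤n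
leadingTrues≤length (suc m) p with p zero
... | true  = s≤s (leadingTrues≤length m (p ∘ suc))
... | false = z≤n

leadingTrues-true : ∀ m (p : Fin m → Bool) (i : Fin m) → toℕ i < leadingTrues m p → p i ≡ true
leadingTrues-true (suc m) p i       i<lead       with p zero in p₀
leadingTrues-true (suc m) p zero    _            | true = p₀
leadingTrues-true (suc m) p (suc i) (s≤s i<lead) | true = leadingTrues-true m (p ∘ suc) i i<lead

-- Equivalently: every maximal block of consecutive trues in p has length at most K.
RunsAtMost : ℕ → ∀ m → (Fin m → Bool) → Set
RunsAtMost K zero    p = ⊤
RunsAtMost K (suc m) p = leadingTrues (suc m) p ≤ K × RunsAtMost K m (p ∘ suc)

leadingTrues≤ : ∀ {K} m {p : Fin m → Bool} → RunsAtMost K m p → leadingTrues m p ≤ K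
leadingTrues≤ zero    _           = z≤n
leadingTrues≤ (suc m) (lead≤K , _) = lead≤K

m*n+o≤m*[1+n] : ∀ m n {o} → o ≤ m → m * n + o ≤ m * suc n
m*n+o≤m*[1+n] m n o≤m =
  ≤-trans (+-monoʳ-≤ (m * n) o≤m) (≤-reflexive (trans (+-comm (m * n) m) (sym (*-suc m n))))

count≤runs : ∀ {K} m {p : Fin m → Bool} → RunsAtMost K m p →
             count m p ≤ K * suc (count m (not ∘ p))

-- Strengthened invariant for the induction: the leading block is charged to
-- itself, every later block to the false preceding it.
count≤runs+leading : ∀ {K} m {p : Fin m → Bool} → RunsAtMost K m p →
                     count m p ≤ K * count m (not ∘ p) + leadingTrues m p
count≤runs+leading zero    _ = z≤n
count≤runs+leading (suc m) {p} (_ , runs) with p zero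
... | true  = ≤-trans (s≤s (count≤runs+leading m runs)) (≤-reflexive (sym (+-suc _ _)))
... | false = ≤-trans (count≤runs m runs) (≤-reflexive (sym (+-identityʳ _)))

count≤runs {K} m runs =
  ≤-trans (count≤runs+leading m runs) (m*n+o≤m*[1+n] K _ (leadingTrues≤ m runs))

module _ {G : OrientedGraph} where

  forwardWord : ∀ {m} → OrientedPath G m → Fin m → Bool
  forwardWord W i = arc G (vtx W (inject₁ i)) (vtx W (suc i))

  backwardWord : ∀ {m} → OrientedPath G m → Fin m → Bool
  backwardWord W i = arc G (vtx W (suc i)) (vtx W (inject₁ i))

  backwardWord≗not-forwardWord : ∀ {m} (W : OrientedPath G m) i →
                                 backwardWord W i ≡ not (forwardWord W i)
  backwardWord≗not-forwardWord W i with forwardWord W i in fwd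
  ... | true  = oriented G _ _ fwd
  ... | false = subst (λ b → (b ∨ backwardWord W i) ≡ true) fwd (adjacent W i)

  numBackward≡count-not-forward : ∀ {m} (W : OrientedPath G m) →
                                  numBackward W ≡ count m (not ∘ forwardWord W)
  numBackward≡count-not-forward {m} W = count-cong m (backwardWord≗not-forwardWord W)

  numForward+numBackward : ∀ {m} (W : OrientedPath G m) → numForward W + numBackward W ≡ m
  numForward+numBackward {m} W =
    trans (cong (numForward W +_) (numBackward≡count-not-forward W)) (count-complement m _)

  tail : ∀ {m} → OrientedPath G (suc m) → OrientedPath G m
  tail W = record
    { vtx      = vtx W ∘ suc
    ; distinct = λ i j → suc-injective ∘ distinct W (suc i) (suc j)
    ; adjacent = adjacent W ∘ suc
    }

  init : ∀ {m} → OrientedPath G (suc m) → OrientedPath G m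
  init W = record
    { vtx      = vtx W ∘ inject₁
    ; distinct = λ i j → inject₁-injective ∘ distinct W (inject₁ i) (inject₁ j)
    ; adjacent = adjacent W ∘ inject₁
    }

  directedPrefix : ∀ {m ℓ} (W : OrientedPath G m) →
                   ℓ ≤ leadingTrues m (forwardWord W) → DirectedPath G ℓ
  directedPrefix {m} {ℓ} W ℓ≤lead = record
    { vtx      = vtx W ∘ embed
    ; distinct = λ i j → inject≤-injective _ _ i j ∘ distinct W (embed i) (embed j)
    ; forward  = forward
    }
    where
    ℓ≤m : ℓ ≤ m
    ℓ≤m = ≤-trans ℓ≤lead (leadingTrues≤length m _)

    embed : Fin (suc ℓ) → Fin (suc m)
    embed j = inject≤ j (s≤s ℓ≤m)

    embed-inject₁ : ∀ i → embed (inject₁ i) ≡ inject₁ (inject≤ i ℓ≤m)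
    embed-inject₁ i = toℕ-injective (begin
      toℕ (embed (inject₁ i))      ≡⟨ toℕ-inject≤ (inject₁ i) _ ⟩
      toℕ (inject₁ i)              ≡⟨ toℕ-inject₁ i ⟩
      toℕ i                        ≡⟨ sym (toℕ-inject≤ i ℓ≤m) ⟩
      toℕ (inject≤ i ℓ≤m)          ≡⟨ sym (toℕ-inject₁ (inject≤ i ℓ≤m)) ⟩
      toℕ (inject₁ (inject≤ i ℓ≤m)) ∎)
      where open ≡-Reasoning

    forward : ∀ i → arc G (vtx W (embed (inject₁ i))) (vtx W (embed (suc i))) ≡ true
    forward i =
      subst (λ v → arc G (vtx W v) (vtx W (embed (suc i))) ≡ true) (sym (embed-inject₁ i))
        (leadingTrues-true m (forwardWord W) (inject≤ i ℓ≤m)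
          (subst (_< leadingTrues m (forwardWord W)) (sym (toℕ-inject≤ i ℓ≤m))
            (<-≤-trans (toℕ<n i) ℓ≤lead)))

  forwardWord-runsAtMost : ∀ {K m} → ¬ DirectedPath G (suc K) → (W : OrientedPath G m) →
               RunsAtMost K m (forwardWord W)
  forwardWord-runsAtMost {m = zero}  noPath W = tt
  forwardWord-runsAtMost {m = suc m} noPath W = ≮⇒≥ (noPath ∘ directedPrefix W) , forwardWord-runsAtMost noPath (tail W)

  numForward≤ : ∀ {K m} → ¬ DirectedPath G (suc K) → (W : OrientedPath G m) →
                numForward W ≤ K * suc (numBackward W)
  numForward≤ {m = m} noPath W rewrite numBackward≡count-not-forward W =
    count≤runs m (forwardWord-runsAtMost noPath W)

  finalArcBackward-init : ∀ {m} (W : OrientedPath G (suc m)) → FinalArcBackward W →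
                          numForward W ≡ numForward (init W) × numBackward W ≡ suc (numBackward (init W))
  finalArcBackward-init {m} W last =
    count-init-false m (forwardWord W) (oriented G _ _ last) , count-init-true m (backwardWord W) last

  numForward≤-finalArcBackward : ∀ {K m} → ¬ DirectedPath G (suc K) → (W : OrientedPath G m) →
                                 FinalArcBackward W → 1 ≤ numBackward W × numForward W ≤ K * numBackward W
  numForward≤-finalArcBackward {m = suc m} noPath W last
    with finalArcBackward-init W last
  ... | F≡ , B≡ rewrite F≡ | B≡ = s≤s z≤n , numForward≤ noPath (init W)

blocks≤⇒bounds : ∀ K F B n → F ≤ K * suc B → F + B ≡ suc K * n → F ≤ K * n × n ≤ B
blocks≤⇒bounds K F B n F≤ F+B≡ = F≤Kn , n≤B
  where
  open ≤-Reasoning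

  n≤B : n ≤ B
  n≤B = s≤s⁻¹ (*-cancelˡ-< (suc K) n (suc B) (begin-strict
    suc K * n      ≡⟨ sym F+B≡ ⟩
    F + B          ≤⟨ +-monoˡ-≤ B F≤ ⟩
    K * suc B + B  <⟨ s≤s (≤-reflexive (+-comm (K * suc B) B)) ⟩
    suc K * suc B  ∎))

  F≤Kn : F ≤ K * n
  F≤Kn = +-cancelʳ-≤ n F (K * n) (begin
    F + n          ≤⟨ +-monoʳ-≤ F n≤B ⟩
    F + B          ≡⟨ F+B≡ ⟩
    n + K * n      ≡⟨ +-comm n (K * n) ⟩
    K * n + n      ∎)

mainTheorem16 : (k : ℕ) → k ≥ 4 → (G : OrientedGraph) → Acyclic G → ¬ DirectedPath G k →
    {m : ℕ} (W : OrientedPath G m) →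
    ((n : ℕ) → n ≥ 1 → numArcs W ≡ k * n →
      (numForward W ≤ (k ∸ 1) * n) × (numBackward W ≥ n))
    × (FinalArcBackward W →
      Σ ℕ (λ n → (n ≥ 1) × (numForward W ≤ (k ∸ 1) * n) × (numBackward W ≥ n)))
mainTheorem16 (suc K) _ G _ noPath W = part1 , part2
  where
  part1 : ∀ n → n ≥ 1 → numArcs W ≡ suc K * n → numForward W ≤ K * n × numBackward W ≥ n
  part1 n _ arcs =
    blocks≤⇒bounds K _ _ n (numForward≤ noPath W) (trans (numForward+numBackward W) arcs)

  part2 : FinalArcBackward W →
          Σ ℕ (λ n → (n ≥ 1) × (numForward W ≤ K * n) × (numBackward W ≥ n))
  part2 last with numForward≤-finalArcBackward noPath W last
  ... | B≥1 , F≤KB = numBackward W , B≥1 , F≤KB , ≤-refl
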